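{- Let $G$ and $H$ be finite simple graphs with $i_G$ and $i_H$ isolated vertices, respectively. Then $$\rho_o(G\boxtimes H)\geq \rho(G^-)\rho(H^-)+i_G\rho_o(H)+i_H\rho_o(G)-i_Gi_H$$ and $$\rho_o(G\boxtimes H)\leq \min\{\rho(G^-)\gamma_f(H^-),\ \rho(H^-)\gamma_f(G^-)\}+i_G\rho_o(H)+i_H\rho_o(G)-i_Gi_H.$$
   Context: For a graph $G$, $G^-$ denotes the graph obtained from $G$ by removing all isolated vertices. A packing is a set $P\subseteq V(G)$ with $N_G[u]\cap N_G[v]=\emptyset$ for distinct $u,v\in P$ (closed neighborhoods), and $\rho(G)$ is the maximum size of a packing; an open packing is a set $P$ with $N_G(u)\cap N_G(v)=\emptyset$ for distinct $u,v\in P$ (open neighborhoods), and $\rho_o(G)$ is the maximum size of an open packing. The fractional domination number $\gamma_f(G)$ is the minimum of $\sum_{v\in V(G)}f(v)$ over all functions $f:V(G)\to[0,1]$ with $\sum_{u\in N_G[v]}f(u)\geq 1$ for every $v\in V(G)$. The strong product $G\boxtimes H$ has vertex set $V(G)\times V(H)$, with distinct $(g,h),(g',h')$ adjacent iff ($g=g'$ or $gg'\in E(G)$) and ($h=h'$ or $hh'\in E(H)$).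
   Formalization: The functions f in the definition of the fractional domination number γ_f take rational values in [0,1] rather than arbitrary real values. -}

module Defs where

open import Data.Bool using (Bool; true; false; not; _∨_; T)
open import Data.Nat using (ℕ; _≤_; _*_)
open import Data.Fin using (Fin; remQuot; _≟_)
open import Data.Fin.Subset using (Subset; _∈_; ∣_∣)
open import Data.List using (List; length; filterᵇ; allFin; lookup; foldr; map)
open import Data.Bool.ListAction using (any)
open import Data.Product using (Σ; ∃; _×_; _,_; proj₁; proj₂)
open import Data.Rational using (ℚ; 0ℚ; 1ℚ; _+_) renaming (_≤_ to _≤ℚ_)
open import Relation.Nullary using (¬_; does)
open import Relation.Binary.PropositionalEquality using (_≡_; _≢_)

record Graph (n : ℕ) : Set where
  field
    adj    : Fin n → Fin n → Bool
    sym    : ∀ u v → adj u v ≡ adj v u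
    irrefl : ∀ v → adj v v ≡ false
open Graph public

_∈N[_]_ : ∀ {n} → Fin n → Graph n → Fin n → Set
w ∈N[ G ] v = T (adj G v w)

closedAdj : ∀ {n} → Graph n → Fin n → Fin n → Bool
closedAdj G v w = does (v ≟ w) ∨ adj G v w

_∈N̄[_]_ : ∀ {n} → Fin n → Graph n → Fin n → Set
w ∈N̄[ G ] v = T (closedAdj G v w)

isIsolated : ∀ {n} → Graph n → Fin n → Bool
isIsolated {n} G v = not (any (adj G v) (allFin n))

isolatedCount : ∀ {n} → Graph n → ℕ
isolatedCount {n} G = length (filterᵇ (isIsolated G) (allFin n))

-- G⁻ : remove isolated vertices (remaining vertices listed in increasing order)
nonIsolated : ∀ {n} → Graph n → List (Fin n)
nonIsolated {n} G = filterᵇ (λ v → not (isIsolated G v)) (allFin n)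

minusSize : ∀ {n} → Graph n → ℕ
minusSize G = length (nonIsolated G)

_⁻ : ∀ {n} → (G : Graph n) → Graph (minusSize G)
G ⁻ = record
  { adj    = λ i j → adj G (lookup (nonIsolated G) i) (lookup (nonIsolated G) j)
  ; sym    = λ i j → sym G (lookup (nonIsolated G) i) (lookup (nonIsolated G) j)
  ; irrefl = λ i → irrefl G (lookup (nonIsolated G) i)
  }

-- Strong product on Fin (n * m), a vertex x corresponding to remQuot {n} m x = (g , h)
eqOrAdj : ∀ {n} → Graph n → Fin n → Fin n → Bool
eqOrAdj = closedAdj

strongAdj : ∀ {n m} → Graph n → Graph m → Fin (n * m) → Fin (n * m) → Bool
strongAdj {n} {m} G H x y =
  not (does (x ≟ y)) Data.Bool.∧
    (eqOrAdj G (proj₁ (remQuot {n} m x)) (proj₁ (remQuot {n} m y)) Data.Bool.∧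
     eqOrAdj H (proj₂ (remQuot {n} m x)) (proj₂ (remQuot {n} m y)))
  where import Data.Bool

open import Data.Bool.Properties using (∧-comm; ∨-comm)
open import Relation.Binary.PropositionalEquality using (refl; cong₂; sym; trans; cong)
open import Relation.Nullary using (yes; no)
import Data.Bool as B

private
  closedSym : ∀ {n} (G : Graph n) u v → closedAdj G u v ≡ closedAdj G v u
  closedSym G u v with u ≟ v | v ≟ u
  ... | yes _ | yes _ = refl
  ... | no _  | no _  = Graph.sym G u v
  ... | yes refl | no ¬p with ¬p refl
  ... | ()
  closedSym G u v | no ¬p | yes refl with ¬p refl
  ... | ()

  eqSym : ∀ {k} (x y : Fin k) → does (x ≟ y) ≡ does (y ≟ x)
  eqSym x y with x ≟ y | y ≟ x
  ... | yes _ | yes _ = refl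
  ... | no _  | no _  = refl
  ... | yes refl | no ¬p with ¬p refl
  ... | ()
  eqSym x y | no ¬p | yes refl with ¬p refl
  ... | ()

  strongSym : ∀ {n m} (G : Graph n) (H : Graph m) x y → strongAdj G H x y ≡ strongAdj G H y x
  strongSym {n} {m} G H x y =
    cong₂ B._∧_ (cong not (eqSym x y))
      (cong₂ B._∧_ (closedSym G (proj₁ (remQuot {n} m x)) (proj₁ (remQuot {n} m y))) (closedSym H (proj₂ (remQuot {n} m x)) (proj₂ (remQuot {n} m y))))

  strongIrr : ∀ {n m} (G : Graph n) (H : Graph m) x → strongAdj G H x x ≡ false
  strongIrr {n} {m} G H x with x ≟ x
  ... | yes _ = refl
  ... | no ¬p with ¬p refl
  ... | ()

_⊠_ : ∀ {n m} → Graph n → Graph m → Graph (n * m)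
G ⊠ H = record { adj = strongAdj G H ; sym = strongSym G H ; irrefl = strongIrr G H }

IsPacking : ∀ {n} → Graph n → Subset n → Set
IsPacking G P = ∀ u v → u ∈ P → v ∈ P → u ≢ v →
  ∀ w → ¬ (w ∈N̄[ G ] u × w ∈N̄[ G ] v)

IsOpenPacking : ∀ {n} → Graph n → Subset n → Set
IsOpenPacking G P = ∀ u v → u ∈ P → v ∈ P → u ≢ v →
  ∀ w → ¬ (w ∈N[ G ] u × w ∈N[ G ] v)

IsPackingNumber : ∀ {n} → Graph n → ℕ → Set
IsPackingNumber G k =
  (Σ _ λ P → IsPacking G P × ∣ P ∣ ≡ k) × (∀ P → IsPacking G P → ∣ P ∣ ≤ k)

IsOpenPackingNumber : ∀ {n} → Graph n → ℕ → Set
IsOpenPackingNumber G k =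
  (Σ _ λ P → IsOpenPacking G P × ∣ P ∣ ≡ k) × (∀ P → IsOpenPacking G P → ∣ P ∣ ≤ k)

sumFin : ∀ {n} → (Fin n → ℚ) → ℚ
sumFin {n} f = foldr _+_ 0ℚ (map f (allFin n))

IsFracDom : ∀ {n} → Graph n → (Fin n → ℚ) → Set
IsFracDom G f =
  (∀ v → (0ℚ ≤ℚ f v) × (f v ≤ℚ 1ℚ)) ×
  (∀ v → 1ℚ ≤ℚ sumFin (λ u → if closedAdj G v u then f u else 0ℚ))
  where open Data.Bool using (if_then_else_)

weight : ∀ {n} → (Fin n → ℚ) → ℚ
weight = sumFin

IsFracDomNumber : ∀ {n} → Graph n → ℚ → Set
IsFracDomNumber G q =
  (Σ _ λ f → IsFracDom G f × weight f ≡ q) × (∀ f → IsFracDom G f → q ≤ℚ weight f)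

{-# OPTIONS --safe #-}
-- Write I_G, I_H for the isolated vertices. Split an open packing P of G ⊠ H by which coordinates
-- of its points are isolated. Where neither is, two points whose closed neighbourhoods meet also
-- have a common open neighbour (each coordinate has a neighbour to step to), so this part of P
-- is a packing of G⁻ ⊠ H⁻. For t ∈ V(H⁻), the first coordinates of its points whose second
-- coordinate lies in N[t] form a packing of G⁻; weighting these counts with a fractional
-- dominating function of H⁻ bounds the part by ρ(G⁻) γ_f(H⁻), and symmetrically. For isolated g,
-- the row {g} × V(H) of P together with I_H is an open packing of H, which accounts for
-- i_G ρ_o(H) - i_G i_H; the columns over isolated h contribute at most i_H ρ_o(G).
-- Conversely, for packings P_G, P_H of G⁻, H⁻ and open packings O_G, O_H of G, H, the set
-- (P_G × P_H) ∪ (I_G × O_H) ∪ (O_G × I_H) is an open packing of G ⊠ H whose last two parts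
-- overlap only inside I_G × I_H.
module Submission where

open import Defs hiding (sym)
open import Data.Nat using (ℕ; _≤_; _+_; _*_)
open import Data.Integer using (+_)
open import Data.Rational using (ℚ; _/_; _⊓_) renaming (_≤_ to _≤ℚ_; _+_ to _+ℚ_; _*_ to _*ℚ_)
open import Data.Product using (_×_)

open import Algebra.Bundles using (Ring)
import Algebra.Properties.Semiring.Sum as SemiringSum
open import Data.Bool using (Bool; true; false; not; T; _∧_; _∨_; if_then_else_)
open import Data.Bool.Properties using (T?; T-∧; T-∨; T-≡)
open import Data.Empty using (⊥-elim)
open import Data.Fin using (Fin; zero; suc; _≟_; remQuot; combine; _↑ˡ_; _↑ʳ_)
open import Data.Fin.Properties using (any?; suc-injective; remQuot-combine; combine-remQuot)
open import Data.Fin.Subset using (Subset; _∈_; ∣_∣)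
open import Data.Fin.Subset.Properties using (_∈?_)
import Data.Integer as ℤ
import Data.Integer.Properties as ℤ
open import Data.List using (List; allFin; filterᵇ; length)
import Data.List as List
import Data.List.Relation.Unary.All as All
open import Data.List.Membership.Propositional.Properties using (∈-lookup; ∈-filter⁺; ∈-filter⁻; ∈-allFin)
open import Data.List.Membership.Propositional using (lose)
open import Data.List.Relation.Unary.Any using (index; satisfied)
open import Data.List.Relation.Unary.Any.Properties using (lookup-index; any⁺; any⁻)
open import Data.List.Relation.Unary.AllPairs using (_∷_)
open import Data.List.Relation.Unary.Unique.Propositional using (Unique)
import Data.List.Relation.Unary.Unique.Propositional.Properties as Unique
open import Data.Nat using (zero; suc; z≤n; s≤s)
import Data.Nat.Coprimality as Coprimality
open import Data.Nat.Properties as ℕ using (+-mono-≤; +-monoˡ-≤; *-mono-≤; *-comm; +-assoc; +-identityʳ; ≤-refl; ≤-reflexive; ≤-trans; module ≤-Reasoning)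
open import Data.Nat.Solver using (module +-*-Solver)
open import Data.Product using (∃; _,_; proj₁; proj₂; uncurry; swap; map; map₂)
open import Data.Product.Properties using (≡-dec; ×-≡,≡→≡)
open import Data.Rational using (mkℚ; 0ℚ; 1ℚ; nonNegative)
import Data.Rational as ℚ
import Data.Rational.Properties as ℚ
open import Data.Sum using (_⊎_; inj₁; inj₂)
import Data.Vec as Vec
open import Data.Vec.Properties using ([]=⇒lookup; lookup⇒[]=; lookup∘tabulate)
open import Function using (_∘_; id; Equivalence)
open import Relation.Nullary using (¬_; Dec; yes; no; contradiction)
open import Relation.Nullary.Decidable using (isYes; toWitness; fromWitness; _×-dec_)
open import Relation.Binary.PropositionalEquality

open SemiringSum ℕ.+-*-semiring using (sum; sum-cong-≗; ∑-comm; ∑-distrib-+; sum-replicate-zero; *-distribʳ-sum)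

sum-mono-≤ : ∀ {k} {f g : Fin k → ℕ} → (∀ i → f i ≤ g i) → sum f ≤ sum g
sum-mono-≤ {zero}  f≤g = z≤n
sum-mono-≤ {suc k} f≤g = +-mono-≤ (f≤g zero) (sum-mono-≤ (f≤g ∘ suc))

sum-↑ : ∀ a b (f : Fin (a + b) → ℕ) → sum f ≡ sum (f ∘ (_↑ˡ b)) + sum (f ∘ (a ↑ʳ_))
sum-↑ zero    b f = refl
sum-↑ (suc a) b f = trans (cong (_+_ (f zero)) (sum-↑ a b (f ∘ suc))) (sym (+-assoc (f zero) _ _))

sum-combine : ∀ n m (f : Fin (n * m) → ℕ) → sum f ≡ sum (λ g → sum (λ h → f (combine {n} {m} g h)))
sum-combine zero    m f = refl
sum-combine (suc n) m f = trans (sum-↑ m (n * m) f) (cong (_+_ (sum (f ∘ (_↑ˡ n * m)))) (sum-combine n m (f ∘ (m ↑ʳ_))))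

𝟙 : Bool → ℕ
𝟙 b = if b then 1 else 0

count : ∀ {k} → (Fin k → Bool) → ℕ
count p = sum (𝟙 ∘ p)

count-none : ∀ {k} (p : Fin k → Bool) → (∀ i → ¬ T (p i)) → count p ≡ 0
count-none {zero}  p none = refl
count-none {suc k} p none with p zero in eq
... | true  = ⊥-elim (none zero (subst T (sym eq) _))
... | false = count-none (p ∘ suc) (none ∘ suc)

count-unique : ∀ {k} (p : Fin k → Bool) → (∀ i j → T (p i) → T (p j) → i ≡ j) → count p ≤ 1
count-unique {zero}  p unique = z≤n
count-unique {suc k} p unique with p zero in eq
... | false = count-unique (p ∘ suc) λ i j pi pj → suc-injective (unique (suc i) (suc j) pi pj)
... | true  = ≤-reflexive (cong suc (count-none (p ∘ suc) λ i pi → zero≢suc (unique zero (suc i) (subst T (sym eq) _) pi)))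
  where
  zero≢suc : ∀ {k} {i : Fin k} → zero ≢ suc i
  zero≢suc ()

count≤𝟙-any : ∀ {k} (p : Fin k → Bool) → (∀ i j → T (p i) → T (p j) → i ≡ j) →
  count p ≤ 𝟙 (isYes (any? (T? ∘ p)))
count≤𝟙-any p unique with any? (T? ∘ p)
... | yes _ = count-unique p unique
... | no ∄  = ≤-reflexive (count-none p λ i pi → ∄ (i , pi))

count-× : ∀ {n m} (a : Fin n → Bool) (b : Fin m → Bool) →
  sum (λ g → count (λ h → a g ∧ b h)) ≡ count a * count b
count-× {n} {m} a b = trans (sum-cong-≗ row) (sym (*-distribʳ-sum (count b) (𝟙 ∘ a)))
  where
  row : ∀ g → count (λ h → a g ∧ b h) ≡ 𝟙 (a g) * count b
  row g with a g
  ... | true  = sym (+-identityʳ (count b))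
  ... | false = sum-replicate-zero m

sum-if : ∀ {k} (c : Bool) (f : Fin k → ℕ) → sum (λ i → if c then f i else 0) ≡ (if c then sum f else 0)
sum-if {k} true  f = refl
sum-if {k} false f = sum-replicate-zero k

count*≡sum-if : ∀ {k} (c : Fin k → Bool) x → count c * x ≡ sum (λ i → if c i then x else 0)
count*≡sum-if c x = trans (*-distribʳ-sum x (𝟙 ∘ c)) (sum-cong-≗ (λ i → 𝟙*x (c i)))
  where
  𝟙*x : ∀ b → 𝟙 b * x ≡ (if b then x else 0)
  𝟙*x true  = +-identityʳ x
  𝟙*x false = refl

sum-if≤count* : ∀ {k} (c : Fin k → Bool) (f : Fin k → ℕ) x → (∀ i → f i ≤ x) →
  sum (λ i → if c i then f i else 0) ≤ count c * x
sum-if≤count* c f x f≤x = subst (_ ≤_) (sym (count*≡sum-if c x)) (sum-mono-≤ pointwise)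
  where
  pointwise : ∀ i → (if c i then f i else 0) ≤ (if c i then x else 0)
  pointwise i with c i
  ... | true  = f≤x i
  ... | false = z≤n

split-if : ∀ b x → x ≡ (if not b then x else 0) + (if b then x else 0)
split-if true  x = refl
split-if false x = sym (+-identityʳ x)

𝟙-union-bound : ∀ x y z w → (T x → ¬ T y) → (T x → ¬ T z) → (T y → T z → T w) →
  𝟙 x + 𝟙 y + 𝟙 z ≤ 𝟙 (x ∨ y ∨ z) + 𝟙 w
𝟙-union-bound true  true  _     _     x⇒¬y _    _   = contradiction _ (x⇒¬y _)
𝟙-union-bound true  false true  _     _    x⇒¬z _   = contradiction _ (x⇒¬z _)
𝟙-union-bound true  false false _     _    _    _   = s≤s z≤n
𝟙-union-bound false true  true  true  _    _    _   = ≤-refl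
𝟙-union-bound false true  true  false _    _    y∧z⇒w = ⊥-elim (y∧z⇒w _ _)
𝟙-union-bound false true  false _     _    _    _   = s≤s z≤n
𝟙-union-bound false false true  _     _    _    _   = s≤s z≤n
𝟙-union-bound false false false _     _    _    _   = z≤n

module ℚΣ = SemiringSum (Ring.semiring ℚ.+-*-ring)

toℚ : ℕ → ℚ
toℚ k = (+ k) / 1

toℚ≡mkℚ : ∀ k → toℚ k ≡ mkℚ (+ k) 0 (Coprimality.sym (Coprimality.1-coprimeTo k))
toℚ≡mkℚ k = ℚ.normalize-coprime (Coprimality.sym (Coprimality.1-coprimeTo k))

toℚ-+ : ∀ a b → toℚ (a + b) ≡ toℚ a +ℚ toℚ b
toℚ-+ a b rewrite toℚ≡mkℚ a | toℚ≡mkℚ b =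
  sym (cong (_/ 1) (cong₂ ℤ._+_ (ℤ.*-identityʳ (+ a)) (ℤ.*-identityʳ (+ b))))

toℚ-mono : ∀ {a b} → a ≤ b → toℚ a ≤ℚ toℚ b
toℚ-mono {a} {b} a≤b rewrite toℚ≡mkℚ a | toℚ≡mkℚ b =
  ℚ.*≤* (subst₂ ℤ._≤_ (sym (ℤ.*-identityʳ (+ a))) (sym (ℤ.*-identityʳ (+ b))) (ℤ.+≤+ a≤b))

toℚ-sum : ∀ {k} (f : Fin k → ℕ) → ℚΣ.sum (toℚ ∘ f) ≡ toℚ (sum f)
toℚ-sum {zero}  f = refl
toℚ-sum {suc k} f = trans (cong (toℚ (f zero) +ℚ_) (toℚ-sum (f ∘ suc))) (sym (toℚ-+ (f zero) _))

sumℚ-mono-≤ : ∀ {k} {f g : Fin k → ℚ} → (∀ i → f i ≤ℚ g i) → ℚΣ.sum f ≤ℚ ℚΣ.sum g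
sumℚ-mono-≤ {zero}  f≤g = ℚ.≤-refl
sumℚ-mono-≤ {suc k} f≤g = ℚ.+-mono-≤ (f≤g zero) (sumℚ-mono-≤ (f≤g ∘ suc))

sumFin≡sum : ∀ {k} (f : Fin k → ℚ) → sumFin f ≡ ℚΣ.sum f
sumFin≡sum {k} f = go id
  where
  go : ∀ {n} (g : Fin n → Fin k) → List.foldr _+ℚ_ 0ℚ (List.map f (List.tabulate g)) ≡ ℚΣ.sum (f ∘ g)
  go {zero}  g = refl
  go {suc n} g = cong (f (g zero) +ℚ_) (go (g ∘ suc))

-- Double counting: Σⱼ aⱼ ≤ Σⱼ aⱼ f(N[j]) = Σₜ f(t) a(N[t]) ≤ ρ Σₜ f(t).
weak-duality : ∀ {b} (K : Graph b) (f : Fin b → ℚ) → IsFracDom K f → (a : Fin b → ℕ) (ρ : ℕ) →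
  (∀ t → sum (λ j → if closedAdj K j t then a j else 0) ≤ ρ) →
  toℚ (sum a) ≤ℚ toℚ ρ *ℚ weight f
weak-duality {b} K f (f-bounds , f-dominates) a ρ a-bounded = begin
  toℚ (sum a)                                     ≡⟨ toℚ-sum a ⟨
  ℚΣ.sum (λ j → toℚ (a j))                        ≤⟨ sumℚ-mono-≤ a≤a*dom ⟩
  ℚΣ.sum (λ j → toℚ (a j) *ℚ ℚΣ.sum (E j))        ≡⟨ ℚΣ.sum-cong-≗ (λ j → ℚΣ.*-distribˡ-sum (toℚ (a j)) (E j)) ⟩
  ℚΣ.sum (λ j → ℚΣ.sum (λ t → toℚ (a j) *ℚ E j t)) ≡⟨ ℚΣ.∑-comm (λ j t → toℚ (a j) *ℚ E j t) ⟩
  ℚΣ.sum (λ t → ℚΣ.sum (λ j → toℚ (a j) *ℚ E j t)) ≡⟨ ℚΣ.sum-cong-≗ column ⟩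
  ℚΣ.sum (λ t → f t *ℚ toℚ (A t))                  ≤⟨ sumℚ-mono-≤ (λ t → ℚ.*-monoˡ-≤-nonNeg (f t) {{f≥0 t}} (toℚ-mono (a-bounded t))) ⟩
  ℚΣ.sum (λ t → f t *ℚ toℚ ρ)                     ≡⟨ ℚΣ.*-distribʳ-sum (toℚ ρ) f ⟨
  ℚΣ.sum f *ℚ toℚ ρ                               ≡⟨ cong₂ _*ℚ_ (sumFin≡sum f) refl ⟨
  weight f *ℚ toℚ ρ                               ≡⟨ ℚ.*-comm (weight f) (toℚ ρ) ⟩
  toℚ ρ *ℚ weight f                               ∎
  where
  open ℚ.≤-Reasoning
  E : Fin b → Fin b → ℚ
  E j t = if closedAdj K j t then f t else 0ℚ
  aN̄ : Fin b → Fin b → ℕ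
  aN̄ t j = if closedAdj K j t then a j else 0
  A : Fin b → ℕ
  A t = sum (aN̄ t)
  f≥0 : ∀ t → ℚ.NonNegative (f t)
  f≥0 t = nonNegative (proj₁ (f-bounds t))
  a≤a*dom : ∀ j → toℚ (a j) ≤ℚ toℚ (a j) *ℚ ℚΣ.sum (E j)
  a≤a*dom j = ℚ.≤-trans (ℚ.≤-reflexive (sym (ℚ.*-identityʳ (toℚ (a j)))))
    (ℚ.*-monoˡ-≤-nonNeg (toℚ (a j)) {{nonNegative (toℚ-mono {0} {a j} z≤n)}} (subst (1ℚ ≤ℚ_) (sumFin≡sum (E j)) (f-dominates j)))
  entry : ∀ t j → toℚ (a j) *ℚ E j t ≡ f t *ℚ toℚ (aN̄ t j)
  entry t j with closedAdj K j t
  ... | true  = ℚ.*-comm (toℚ (a j)) (f t)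
  ... | false = trans (ℚ.*-zeroʳ (toℚ (a j))) (sym (ℚ.*-zeroʳ (f t)))
  column : ∀ t → ℚΣ.sum (λ j → toℚ (a j) *ℚ E j t) ≡ f t *ℚ toℚ (A t)
  column t = begin-equality
    ℚΣ.sum (λ j → toℚ (a j) *ℚ E j t)      ≡⟨ ℚΣ.sum-cong-≗ (entry t) ⟩
    ℚΣ.sum (λ j → f t *ℚ toℚ (aN̄ t j))    ≡⟨ ℚΣ.*-distribˡ-sum (f t) (toℚ ∘ aN̄ t) ⟨
    f t *ℚ ℚΣ.sum (λ j → toℚ (aN̄ t j))    ≡⟨ cong (f t *ℚ_) (toℚ-sum (aN̄ t)) ⟩
    f t *ℚ toℚ (A t)                       ∎

T-not : ∀ {b} → ¬ T b → T (not b)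
T-not {true}  ¬b = ¬b _
T-not {false} _  = _

not-T : ∀ {b} → T (not b) → ¬ T b
not-T {true} ()

¬T-not⇒T : ∀ {b} → ¬ T (not b) → T b
¬T-not⇒T {true}  _   = _
¬T-not⇒T {false} ¬nb = ¬nb _

module _ {n} (G : Graph n) where

  ∈N-sym : ∀ {u v} → u ∈N[ G ] v → v ∈N[ G ] u
  ∈N-sym {u} {v} = subst T (Graph.sym G v u)

  ∈N⇒≢ : ∀ {u v} → u ∈N[ G ] v → v ≢ u
  ∈N⇒≢ {u} u∈Nv refl = subst T (irrefl G u) u∈Nv

  ∈N̄-refl : ∀ v → v ∈N̄[ G ] v
  ∈N̄-refl v with v ≟ v
  ... | yes _  = _
  ... | no v≢v = contradiction refl v≢v

  ∈N⇒∈N̄ : ∀ {u v} → u ∈N[ G ] v → u ∈N̄[ G ] v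
  ∈N⇒∈N̄ {u} {v} u∈Nv with v ≟ u
  ... | yes _ = _
  ... | no _  = u∈Nv

  ∈N̄⇒≡⊎∈N : ∀ {u v} → u ∈N̄[ G ] v → v ≡ u ⊎ u ∈N[ G ] v
  ∈N̄⇒≡⊎∈N {u} {v} u∈N̄v with v ≟ u
  ... | yes v≡u = inj₁ v≡u
  ... | no _    = inj₂ u∈N̄v

  ∈N̄∧≢⇒∈N : ∀ {u v} → u ∈N̄[ G ] v → v ≢ u → u ∈N[ G ] v
  ∈N̄∧≢⇒∈N u∈N̄v v≢u with ∈N̄⇒≡⊎∈N u∈N̄v
  ... | inj₁ v≡u  = contradiction v≡u v≢u
  ... | inj₂ u∈Nv = u∈Nv

  ∈N̄-sym : ∀ {u v} → u ∈N̄[ G ] v → v ∈N̄[ G ] u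
  ∈N̄-sym {u} u∈N̄v with ∈N̄⇒≡⊎∈N u∈N̄v
  ... | inj₁ refl = ∈N̄-refl u
  ... | inj₂ u∈Nv = ∈N⇒∈N̄ (∈N-sym u∈Nv)

  Isolated : Fin n → Set
  Isolated v = T (isIsolated G v)

  isolated⇒∉N : ∀ {u v} → Isolated v → ¬ u ∈N[ G ] v
  isolated⇒∉N {u} {v} iso u∈Nv = not-T iso (any⁺ (adj G v) (lose (∈-allFin u) u∈Nv))

  nonIsolated⇒∈N : ∀ {v} → ¬ Isolated v → ∃ λ u → u ∈N[ G ] v
  nonIsolated⇒∈N {v} ¬iso = satisfied (any⁻ (adj G v) (allFin n) (¬T-not⇒T ¬iso))

  ∈N̄⇒nonIsolated : ∀ {u v} → ¬ Isolated v → u ∈N̄[ G ] v → ¬ Isolated u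
  ∈N̄⇒nonIsolated ¬iso u∈N̄v with ∈N̄⇒≡⊎∈N u∈N̄v
  ... | inj₁ refl = ¬iso
  ... | inj₂ u∈Nv = λ iso → isolated⇒∉N iso (∈N-sym u∈Nv)

  isolated⇒∈N̄⇒≡ : ∀ {u v} → Isolated v → u ∈N̄[ G ] v → v ≡ u
  isolated⇒∈N̄⇒≡ iso u∈N̄v with ∈N̄⇒≡⊎∈N u∈N̄v
  ... | inj₁ v≡u  = v≡u
  ... | inj₂ u∈Nv = contradiction u∈Nv (isolated⇒∉N iso)

  isolated-∈N̄-meet : ∀ {u v w} → Isolated v → w ∈N̄[ G ] v → w ∈N̄[ G ] u → u ≡ v
  isolated-∈N̄-meet iso w∈N̄v w∈N̄u with isolated⇒∈N̄⇒≡ iso w∈N̄v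
  ... | refl = sym (isolated⇒∈N̄⇒≡ iso (∈N̄-sym w∈N̄u))

  isolated-∈N̄-meet⇒isolated : ∀ {u v w} → Isolated u → w ∈N̄[ G ] u → w ∈N̄[ G ] v → Isolated v
  isolated-∈N̄-meet⇒isolated iso w∈N̄u w∈N̄v = subst Isolated (sym (isolated-∈N̄-meet iso w∈N̄u w∈N̄v)) iso

sum-lookup-filter : ∀ {n} (p : Fin n → Bool) (F : Fin n → ℕ) →
  sum (F ∘ List.lookup (filterᵇ p (allFin n))) ≡ sum (λ v → if p v then F v else 0)
sum-lookup-filter {n} p F = go id
  where
  go : ∀ {k} (g : Fin k → Fin n) →
    sum (F ∘ List.lookup (filterᵇ p (List.tabulate g))) ≡ sum (λ i → if p (g i) then F (g i) else 0)
  go {zero}  g = refl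
  go {suc k} g with p (g zero)
  ... | true  = cong (_+_ (F (g zero))) (go (g ∘ suc))
  ... | false = go (g ∘ suc)

length-filter : ∀ {n} (p : Fin n → Bool) → length (filterᵇ p (allFin n)) ≡ count p
length-filter {n} p = trans (sym (sum-const-1 _)) (sum-lookup-filter p (λ _ → 1))
  where
  sum-const-1 : ∀ k → sum {k} (λ _ → 1) ≡ k
  sum-const-1 zero    = refl
  sum-const-1 (suc k) = cong suc (sum-const-1 k)

lookup-injective : ∀ {A : Set} {xs : List A} → Unique xs → ∀ i j → List.lookup xs i ≡ List.lookup xs j → i ≡ j
lookup-injective (_ ∷ _)      zero    zero    _ = refl
lookup-injective (x∉ ∷ _)     zero    (suc j) e = contradiction e (All.lookup x∉ (∈-lookup j))
lookup-injective (x∉ ∷ _)     (suc i) zero    e = contradiction (sym e) (All.lookup x∉ (∈-lookup i))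
lookup-injective (_ ∷ unique) (suc i) (suc j) e = cong suc (lookup-injective unique i j e)

isolatedCount≡count : ∀ {n} (G : Graph n) → isolatedCount G ≡ count (isIsolated G)
isolatedCount≡count G = length-filter (isIsolated G)

module _ {n} (G : Graph n) where

  private
    nonIsolated? : Fin n → Bool
    nonIsolated? v = not (isIsolated G v)

  embed⁻ : Fin (minusSize G) → Fin n
  embed⁻ = List.lookup (nonIsolated G)

  embed⁻-nonIsolated : ∀ i → ¬ Isolated G (embed⁻ i)
  embed⁻-nonIsolated i = not-T (proj₂ (∈-filter⁻ (T? ∘ nonIsolated?) {xs = allFin n} (∈-lookup i)))

  embed⁻-injective : ∀ {i j} → embed⁻ i ≡ embed⁻ j → i ≡ j
  embed⁻-injective = lookup-injective (Unique.filter⁺ (T? ∘ nonIsolated?) (Unique.allFin⁺ n)) _ _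

  embed⁻-surjective : ∀ {v} → ¬ Isolated G v → ∃ λ i → embed⁻ i ≡ v
  embed⁻-surjective {v} ¬iso = index v∈ , sym (lookup-index v∈)
    where v∈ = ∈-filter⁺ (T? ∘ nonIsolated?) (∈-allFin v) (T-not ¬iso)

  ∈N̄⁻⇒∈N̄ : ∀ {i j} → j ∈N̄[ G ⁻ ] i → embed⁻ j ∈N̄[ G ] embed⁻ i
  ∈N̄⁻⇒∈N̄ {i} j∈N̄i with ∈N̄⇒≡⊎∈N (G ⁻) j∈N̄i
  ... | inj₁ refl = ∈N̄-refl G (embed⁻ i)
  ... | inj₂ j∈Ni = ∈N⇒∈N̄ G j∈Ni

  ∈N̄⇒∈N̄⁻ : ∀ {i j} → embed⁻ j ∈N̄[ G ] embed⁻ i → j ∈N̄[ G ⁻ ] i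
  ∈N̄⇒∈N̄⁻ {i} j∈N̄i with ∈N̄⇒≡⊎∈N G j∈N̄i
  ... | inj₁ e    = subst (_∈N̄[ G ⁻ ] i) (embed⁻-injective e) (∈N̄-refl (G ⁻) i)
  ... | inj₂ j∈Ni = ∈N⇒∈N̄ (G ⁻) j∈Ni

  sum-embed⁻ : ∀ (F : Fin n → ℕ) → sum (F ∘ embed⁻) ≡ sum (λ v → if not (isIsolated G v) then F v else 0)
  sum-embed⁻ = sum-lookup-filter nonIsolated?

∈⇒T : ∀ {n} {P : Subset n} {x} → x ∈ P → T (Vec.lookup P x)
∈⇒T x∈P = Equivalence.from T-≡ ([]=⇒lookup x∈P)

T⇒∈ : ∀ {n} {P : Subset n} {x} → T (Vec.lookup P x) → x ∈ P
T⇒∈ {P = P} {x} t = lookup⇒[]= x P (Equivalence.to T-≡ t)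

∈-tabulate⁻ : ∀ {n} {f : Fin n → Bool} {x} → x ∈ Vec.tabulate f → T (f x)
∈-tabulate⁻ {f = f} {x} x∈ = subst T (lookup∘tabulate f x) (∈⇒T x∈)

∈-tabulate⁺ : ∀ {n} {f : Fin n → Bool} {x} → T (f x) → x ∈ Vec.tabulate f
∈-tabulate⁺ {f = f} {x} fx = T⇒∈ (subst T (sym (lookup∘tabulate f x)) fx)

∣P∣≡count : ∀ {n} (P : Subset n) → ∣ P ∣ ≡ count (Vec.lookup P)
∣P∣≡count Vec.[]          = refl
∣P∣≡count (true  Vec.∷ P) = cong suc (∣P∣≡count P)
∣P∣≡count (false Vec.∷ P) = ∣P∣≡count P

∣tabulate∣≡count : ∀ {n} (f : Fin n → Bool) → ∣ Vec.tabulate f ∣ ≡ count f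
∣tabulate∣≡count f = trans (∣P∣≡count (Vec.tabulate f)) (sum-cong-≗ (cong 𝟙 ∘ lookup∘tabulate f))

openPacking-∈N-meet : ∀ {k} (K : Graph k) {O} → IsOpenPacking K O → ∀ {u v w} → u ∈ O → v ∈ O →
  w ∈N[ K ] u → w ∈N[ K ] v → u ≡ v
openPacking-∈N-meet K op {u} {v} {w} u∈O v∈O w∈Nu w∈Nv with u ≟ v
... | yes u≡v = u≡v
... | no u≢v  = contradiction (w∈Nu , w∈Nv) (op u v u∈O v∈O u≢v w)

openPacking-∪isolated : ∀ {n} (G : Graph n) (p : Fin n → Bool) → IsOpenPacking G (Vec.tabulate p) →
  IsOpenPacking G (Vec.tabulate (λ v → isIsolated G v ∨ p v))
openPacking-∪isolated G p op u v u∈ v∈ u≢v w (w∈Nu , w∈Nv) =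
  op u v (member u∈ w∈Nu) (member v∈ w∈Nv) u≢v w (w∈Nu , w∈Nv)
  where
  member : ∀ {x} → x ∈ Vec.tabulate (λ v → isIsolated G v ∨ p v) → w ∈N[ G ] x → x ∈ Vec.tabulate p
  member x∈ w∈Nx with Equivalence.to T-∨ (∈-tabulate⁻ x∈)
  ... | inj₁ iso = contradiction w∈Nx (isolated⇒∉N G iso)
  ... | inj₂ px  = ∈-tabulate⁺ px

module _ {a b : ℕ} where

  _∈N̄⟨_⊠_⟩_ : Fin a × Fin b → Graph a → Graph b → Fin a × Fin b → Set
  q ∈N̄⟨ G ⊠ H ⟩ p = proj₁ q ∈N̄[ G ] proj₁ p × proj₂ q ∈N̄[ H ] proj₂ p

  _∈N⟨_⊠_⟩_ : Fin a × Fin b → Graph a → Graph b → Fin a × Fin b → Set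
  q ∈N⟨ G ⊠ H ⟩ p = p ≢ q × q ∈N̄⟨ G ⊠ H ⟩ p

  IsPacking⊠ : Graph a → Graph b → (Fin a × Fin b → Bool) → Set
  IsPacking⊠ G H S = ∀ p q → T (S p) → T (S q) → p ≢ q →
    ∀ w → ¬ (w ∈N̄⟨ G ⊠ H ⟩ p × w ∈N̄⟨ G ⊠ H ⟩ q)

  IsOpenPacking⊠ : Graph a → Graph b → (Fin a × Fin b → Bool) → Set
  IsOpenPacking⊠ G H S = ∀ p q → T (S p) → T (S q) → p ≢ q →
    ∀ w → ¬ (w ∈N⟨ G ⊠ H ⟩ p × w ∈N⟨ G ⊠ H ⟩ q)

  sum² : (Fin a × Fin b → ℕ) → ℕ
  sum² F = sum (λ g → sum (λ h → F (g , h)))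

  count² : (Fin a × Fin b → Bool) → ℕ
  count² S = sum² (𝟙 ∘ S)

  sum²-mono-≤ : ∀ {F F′ : Fin a × Fin b → ℕ} → (∀ p → F p ≤ F′ p) → sum² F ≤ sum² F′
  sum²-mono-≤ F≤F′ = sum-mono-≤ (λ g → sum-mono-≤ (λ h → F≤F′ (g , h)))

  sum²-distrib-+ : ∀ (F F′ : Fin a × Fin b → ℕ) → sum² (λ p → F p + F′ p) ≡ sum² F + sum² F′
  sum²-distrib-+ F F′ = trans (sum-cong-≗ (λ g → ∑-distrib-+ (λ h → F (g , h)) (λ h → F′ (g , h))))
                              (∑-distrib-+ (λ g → sum (λ h → F (g , h))) (λ g → sum (λ h → F′ (g , h))))

count²-swap : ∀ {a b} (S : Fin a × Fin b → Bool) → count² (S ∘ swap) ≡ count² S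
count²-swap S = ∑-comm (λ h g → 𝟙 (S (g , h)))

packing⊠-swap : ∀ {a b} (G : Graph a) (H : Graph b) {S} → IsPacking⊠ G H S → IsPacking⊠ H G (S ∘ swap)
packing⊠-swap G H pk p q Sp Sq p≢q w (w∈p , w∈q) =
  pk (swap p) (swap q) Sp Sq (p≢q ∘ cong swap) (swap w) (swap w∈p , swap w∈q)

module _ {n m} (G : Graph n) (H : Graph m) where

  coords : Fin (n * m) → Fin n × Fin m
  coords = remQuot m

  ⟪_⟫ : Fin n × Fin m → Fin (n * m)
  ⟪_⟫ = uncurry combine

  coords-⟪⟫ : ∀ p → coords ⟪ p ⟫ ≡ p
  coords-⟪⟫ (g , h) = remQuot-combine g h

  coords-injective : ∀ {x y} → coords x ≡ coords y → x ≡ y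
  coords-injective {x} {y} e = trans (sym (combine-remQuot {n} m x)) (trans (cong ⟪_⟫ e) (combine-remQuot {n} m y))

  ⊠-∈N⇒ : ∀ {x y} → y ∈N[ G ⊠ H ] x → coords y ∈N⟨ G ⊠ H ⟩ coords x
  ⊠-∈N⇒ {x} {y} y∈Nx with x ≟ y
  ... | no x≢y = x≢y ∘ coords-injective , Equivalence.to T-∧ y∈Nx

  ⊠-∈N⇐ : ∀ {x y} → coords y ∈N⟨ G ⊠ H ⟩ coords x → y ∈N[ G ⊠ H ] x
  ⊠-∈N⇐ {x} {y} (x≢y , y∈N̄x) with x ≟ y
  ... | yes refl = contradiction refl x≢y
  ... | no _     = Equivalence.from T-∧ y∈N̄x

  ∈N⟨⟩⇒∈N⊠ : ∀ {p q} → q ∈N⟨ G ⊠ H ⟩ p → ⟪ q ⟫ ∈N[ G ⊠ H ] ⟪ p ⟫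
  ∈N⟨⟩⇒∈N⊠ {p} {q} = ⊠-∈N⇐ ∘ subst₂ (_∈N⟨ G ⊠ H ⟩_) (sym (coords-⟪⟫ q)) (sym (coords-⟪⟫ p))

  openPacking⊠⁻ : ∀ {P} → IsOpenPacking (G ⊠ H) P → IsOpenPacking⊠ G H (Vec.lookup P ∘ ⟪_⟫)
  openPacking⊠⁻ op p q Pp Pq p≢q w (w∈p , w∈q) =
    op ⟪ p ⟫ ⟪ q ⟫ (T⇒∈ Pp) (T⇒∈ Pq) (p≢q ∘ ⟪⟫-injective) ⟪ w ⟫ (∈N⟨⟩⇒∈N⊠ w∈p , ∈N⟨⟩⇒∈N⊠ w∈q)
    where
    ⟪⟫-injective : ⟪ p ⟫ ≡ ⟪ q ⟫ → p ≡ q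
    ⟪⟫-injective e = trans (sym (coords-⟪⟫ p)) (trans (cong coords e) (coords-⟪⟫ q))

  openPacking⊠⁺ : ∀ {S} → IsOpenPacking⊠ G H S → IsOpenPacking (G ⊠ H) (Vec.tabulate (S ∘ coords))
  openPacking⊠⁺ op x y x∈ y∈ x≢y w (w∈x , w∈y) =
    op (coords x) (coords y) (∈-tabulate⁻ x∈) (∈-tabulate⁻ y∈) (x≢y ∘ coords-injective) (coords w)
       (⊠-∈N⇒ w∈x , ⊠-∈N⇒ w∈y)

  ∣P∣≡count² : ∀ P → ∣ P ∣ ≡ count² (Vec.lookup P ∘ ⟪_⟫)
  ∣P∣≡count² P = trans (∣P∣≡count P) (sum-combine n m _)

  ∣tabulate∣≡count² : ∀ S → ∣ Vec.tabulate (S ∘ coords) ∣ ≡ count² S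
  ∣tabulate∣≡count² S = trans (∣tabulate∣≡count (S ∘ coords)) (trans (sum-combine n m _)
    (sum-cong-≗ λ g → sum-cong-≗ λ h → cong (𝟙 ∘ S) (coords-⟪⟫ (g , h))))

-- Packings of a strong product

packing⊠-column-bound : ∀ {a b} (G : Graph a) (H : Graph b) {r ρ} → IsPacking⊠ G H r →
  (∀ P → IsPacking G P → ∣ P ∣ ≤ ρ) →
  ∀ t → sum (λ j → if closedAdj H j t then count (λ i → r (i , j)) else 0) ≤ ρ
packing⊠-column-bound {a} {b} G H {r} {ρ} pk maxρ t = begin
  sum (λ j → if closedAdj H j t then count (λ i → r (i , j)) else 0) ≡⟨ sum-cong-≗ restrict ⟩
  sum (λ j → count (λ i → near i j))                               ≡⟨ ∑-comm (λ i j → 𝟙 (near i j)) ⟨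
  sum (λ i → count (near i))                                        ≤⟨ sum-mono-≤ (λ i → count≤𝟙-any (near i) (unique i)) ⟩
  count R                                                           ≡⟨ ∣tabulate∣≡count R ⟨
  ∣ Vec.tabulate R ∣                                                ≤⟨ maxρ (Vec.tabulate R) R-packing ⟩
  ρ                                                                 ∎
  where
  open ≤-Reasoning
  near : Fin a → Fin b → Bool
  near i j = closedAdj H j t ∧ r (i , j)
  R : Fin a → Bool
  R i = isYes (any? (T? ∘ near i))
  restrict : ∀ j → (if closedAdj H j t then count (λ i → r (i , j)) else 0) ≡ count (λ i → near i j)
  restrict j with closedAdj H j t
  ... | true  = refl
  ... | false = sym (sum-replicate-zero a)
  unique : ∀ i j j′ → T (near i j) → T (near i j′) → j ≡ j′
  unique i j j′ n n′ with j ≟ j′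
  ... | yes j≡j′ = j≡j′
  ... | no j≢j′  =
    let (t∈N̄j , rij) = Equivalence.to T-∧ n ; (t∈N̄j′ , rij′) = Equivalence.to T-∧ n′
    in contradiction ((∈N̄-refl G i , t∈N̄j) , (∈N̄-refl G i , t∈N̄j′))
         (pk (i , j) (i , j′) rij rij′ (j≢j′ ∘ cong proj₂) (i , t))
  R-packing : IsPacking G (Vec.tabulate R)
  R-packing u v u∈R v∈R u≢v w (w∈N̄u , w∈N̄v) =
    let (j , n) = toWitness (∈-tabulate⁻ u∈R) ; (j′ , n′) = toWitness (∈-tabulate⁻ v∈R)
        (t∈N̄j , ruj) = Equivalence.to T-∧ n ; (t∈N̄j′ , rvj′) = Equivalence.to T-∧ n′
    in pk (u , j) (v , j′) ruj rvj′ (u≢v ∘ cong proj₁) (w , t) ((w∈N̄u , t∈N̄j) , (w∈N̄v , t∈N̄j′))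

packing⊠-bound : ∀ {a b} (G : Graph a) (H : Graph b) {r ρ f} → IsPacking⊠ G H r →
  (∀ P → IsPacking G P → ∣ P ∣ ≤ ρ) → IsFracDom H f → toℚ (count² r) ≤ℚ toℚ ρ *ℚ weight f
packing⊠-bound G H {r} {ρ} {f} pk maxρ f-dom =
  subst (λ c → toℚ c ≤ℚ toℚ ρ *ℚ weight f) (sym (∑-comm (λ i j → 𝟙 (r (i , j)))))
    (weak-duality H f f-dom (λ j → count (λ i → r (i , j))) ρ (packing⊠-column-bound G H pk maxρ))

module _ {a b} (G : Graph a) (H : Graph b) where

  ∈N̄⊠-sym : ∀ {p q} → q ∈N̄⟨ G ⊠ H ⟩ p → p ∈N̄⟨ G ⊠ H ⟩ q
  ∈N̄⊠-sym (q₁∈N̄p₁ , q₂∈N̄p₂) = ∈N̄-sym G q₁∈N̄p₁ , ∈N̄-sym H q₂∈N̄p₂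

  ∈N⊠⇒∈N₁ : ∀ {p q} → q ∈N⟨ G ⊠ H ⟩ p → proj₂ p ≡ proj₂ q → proj₁ q ∈N[ G ] proj₁ p
  ∈N⊠⇒∈N₁ {g , h} {g′ , .h} (p≢q , q₁∈N̄p₁ , _) refl = ∈N̄∧≢⇒∈N G q₁∈N̄p₁ (p≢q ∘ cong (_, h))

  ∈N⊠⇒∈N₂ : ∀ {p q} → q ∈N⟨ G ⊠ H ⟩ p → proj₁ p ≡ proj₁ q → proj₂ q ∈N[ H ] proj₂ p
  ∈N⊠⇒∈N₂ {g , h} {.g , h′} (p≢q , _ , q₂∈N̄p₂) refl = ∈N̄∧≢⇒∈N H q₂∈N̄p₂ (p≢q ∘ cong (g ,_))

  NoIsolatedCoordinate : Fin a × Fin b → Set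
  NoIsolatedCoordinate p = ¬ Isolated G (proj₁ p) × ¬ Isolated H (proj₂ p)

  ∈N⊠-common-neighbour : ∀ {p q} → NoIsolatedCoordinate p → q ∈N⟨ G ⊠ H ⟩ p →
    ∃ λ z → z ∈N⟨ G ⊠ H ⟩ p × z ∈N⟨ G ⊠ H ⟩ q
  ∈N⊠-common-neighbour {g , h} {g′ , h′} (¬iso₁ , ¬iso₂) (_ , g′∈N̄g , h′∈N̄h) = cases (g ≟ g′) (h ≟ h′)
    where
    cases : Dec (g ≡ g′) → Dec (h ≡ h′) → ∃ λ z → z ∈N⟨ G ⊠ H ⟩ (g , h) × z ∈N⟨ G ⊠ H ⟩ (g′ , h′)
    cases (yes refl) _ =
      let (g₂ , g₂∈Ng) = nonIsolated⇒∈N G ¬iso₁ ; g≢g₂ = ∈N⇒≢ G g₂∈Ng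
      in (g₂ , h) , (g≢g₂ ∘ cong proj₁ , ∈N⇒∈N̄ G g₂∈Ng , ∈N̄-refl H h)
                  , (g≢g₂ ∘ cong proj₁ , ∈N⇒∈N̄ G g₂∈Ng , ∈N̄-sym H h′∈N̄h)
    cases (no g≢g′) (yes refl) =
      let (h₂ , h₂∈Nh) = nonIsolated⇒∈N H ¬iso₂ ; h≢h₂ = ∈N⇒≢ H h₂∈Nh
      in (g , h₂) , (h≢h₂ ∘ cong proj₂ , ∈N̄-refl G g , ∈N⇒∈N̄ H h₂∈Nh)
                  , ((g≢g′ ∘ sym) ∘ cong proj₁ , ∈N̄-sym G g′∈N̄g , ∈N⇒∈N̄ H h₂∈Nh)
    cases (no g≢g′) (no h≢h′) =
      (g′ , h) , (g≢g′ ∘ cong proj₁ , g′∈N̄g , ∈N̄-refl H h)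
               , ((h≢h′ ∘ sym) ∘ cong proj₂ , ∈N̄-refl G g′ , ∈N̄-sym H h′∈N̄h)

  ∈N̄⊠-meet⇒∈N⊠-meet : ∀ {p q w} → NoIsolatedCoordinate p → NoIsolatedCoordinate q → p ≢ q →
    w ∈N̄⟨ G ⊠ H ⟩ p → w ∈N̄⟨ G ⊠ H ⟩ q → ∃ λ z → z ∈N⟨ G ⊠ H ⟩ p × z ∈N⟨ G ⊠ H ⟩ q
  ∈N̄⊠-meet⇒∈N⊠-meet {p} {q} {w} p-ok q-ok p≢q w∈p w∈q with ≡-dec _≟_ _≟_ w p | ≡-dec _≟_ _≟_ w q
  ... | yes refl | _        = ∈N⊠-common-neighbour p-ok (p≢q , ∈N̄⊠-sym w∈q)
  ... | no _     | yes refl = map₂ swap (∈N⊠-common-neighbour q-ok (p≢q ∘ sym , ∈N̄⊠-sym w∈p))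
  ... | no w≢p   | no w≢q   = w , ((w≢p ∘ sym) , w∈p) , ((w≢q ∘ sym) , w∈q)

  embed⁻² : Fin (minusSize G) × Fin (minusSize H) → Fin a × Fin b
  embed⁻² = map (embed⁻ G) (embed⁻ H)

  openPacking⊠⇒packing⊠⁻ : ∀ {S} → IsOpenPacking⊠ G H S → IsPacking⊠ (G ⁻) (H ⁻) (S ∘ embed⁻²)
  openPacking⊠⇒packing⊠⁻ op p q Sp Sq p≢q w (w∈p , w∈q) =
    let (z , z∈p , z∈q) = ∈N̄⊠-meet⇒∈N⊠-meet (noIso p) (noIso q) (p≢q ∘ embed⁻²-injective) (lift w∈p) (lift w∈q)
    in op (embed⁻² p) (embed⁻² q) Sp Sq (p≢q ∘ embed⁻²-injective) z (z∈p , z∈q)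
    where
    noIso : ∀ p → NoIsolatedCoordinate (embed⁻² p)
    noIso (i , j) = embed⁻-nonIsolated G i , embed⁻-nonIsolated H j
    embed⁻²-injective : ∀ {p q} → embed⁻² p ≡ embed⁻² q → p ≡ q
    embed⁻²-injective {i , j} {i′ , j′} e = cong₂ _,_ (embed⁻-injective G (cong proj₁ e)) (embed⁻-injective H (cong proj₂ e))
    lift : ∀ {p w} → w ∈N̄⟨ G ⁻ ⊠ H ⁻ ⟩ p → embed⁻² w ∈N̄⟨ G ⊠ H ⟩ embed⁻² p
    lift (w₁∈N̄p₁ , w₂∈N̄p₂) = ∈N̄⁻⇒∈N̄ G w₁∈N̄p₁ , ∈N̄⁻⇒∈N̄ H w₂∈N̄p₂

-- Open packings of G ⊠ H: the upper bound

module _ {n m} (G : Graph n) (H : Graph m) {S : Fin n × Fin m → Bool} (op : IsOpenPacking⊠ G H S) where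

  openPacking⊠-slice₁ : ∀ h → IsOpenPacking G (Vec.tabulate (λ g → S (g , h)))
  openPacking⊠-slice₁ h u v u∈ v∈ u≢v w (w∈Nu , w∈Nv) =
    op (u , h) (v , h) (∈-tabulate⁻ u∈) (∈-tabulate⁻ v∈) (u≢v ∘ cong proj₁) (w , h)
       ((∈N⇒≢ G w∈Nu ∘ cong proj₁ , ∈N⇒∈N̄ G w∈Nu , ∈N̄-refl H h) ,
        (∈N⇒≢ G w∈Nv ∘ cong proj₁ , ∈N⇒∈N̄ G w∈Nv , ∈N̄-refl H h))

  openPacking⊠-slice₂ : ∀ g → IsOpenPacking H (Vec.tabulate (λ h → S (g , h)))
  openPacking⊠-slice₂ g u v u∈ v∈ u≢v w (w∈Nu , w∈Nv) =
    op (g , u) (g , v) (∈-tabulate⁻ u∈) (∈-tabulate⁻ v∈) (u≢v ∘ cong proj₂) (g , w)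
       ((∈N⇒≢ H w∈Nu ∘ cong proj₂ , ∈N̄-refl G g , ∈N⇒∈N̄ H w∈Nu) ,
        (∈N⇒≢ H w∈Nv ∘ cong proj₂ , ∈N̄-refl G g , ∈N⇒∈N̄ H w∈Nv))

  -- The points of S are split into those over V(G⁻) × V(H⁻), over I_G × V(H⁻), and over I_H.
  private
    iG = count (isIsolated G)
    iH = count (isIsolated H)

    onH⁻ onIH : Fin n → Fin m → ℕ
    onH⁻ g h = if not (isIsolated H h) then 𝟙 (S (g , h)) else 0
    onIH g h = if isIsolated H h then 𝟙 (S (g , h)) else 0

    rowH⁻ : Fin n → ℕ
    rowH⁻ g = sum (onH⁻ g)

    onG⁻H⁻ onIGH⁻ : Fin n → ℕ
    onG⁻H⁻ g = if not (isIsolated G g) then rowH⁻ g else 0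
    onIGH⁻ g = if isIsolated G g then rowH⁻ g else 0

  count²-split : count² S ≡ sum onG⁻H⁻ + sum onIGH⁻ + sum (sum ∘ onIH)
  count²-split = begin
    count² S                                            ≡⟨ sum-cong-≗ split-row ⟩
    sum (λ g → onG⁻H⁻ g + onIGH⁻ g + sum (onIH g))     ≡⟨ ∑-distrib-+ (λ g → onG⁻H⁻ g + onIGH⁻ g) (sum ∘ onIH) ⟩
    sum (λ g → onG⁻H⁻ g + onIGH⁻ g) + sum (sum ∘ onIH) ≡⟨ cong (_+ sum (sum ∘ onIH)) (∑-distrib-+ onG⁻H⁻ onIGH⁻) ⟩
    sum onG⁻H⁻ + sum onIGH⁻ + sum (sum ∘ onIH)         ∎
    where
    open ≡-Reasoning
    split-row : ∀ g → count (λ h → S (g , h)) ≡ onG⁻H⁻ g + onIGH⁻ g + sum (onIH g)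
    split-row g = trans (sum-cong-≗ λ h → split-if (isIsolated H h) (𝟙 (S (g , h))))
                 (trans (∑-distrib-+ (onH⁻ g) (onIH g)) (cong (_+ sum (onIH g)) (split-if (isIsolated G g) (rowH⁻ g))))

  sum-onG⁻H⁻≡count²⁻ : sum onG⁻H⁻ ≡ count² (S ∘ embed⁻² G H)
  sum-onG⁻H⁻≡count²⁻ = sym (trans (sum-cong-≗ λ i → sum-embed⁻ H (λ h → 𝟙 (S (embed⁻ G i , h)))) (sum-embed⁻ G rowH⁻))

  isolated-rows-bound : ∀ {ρoH} → (∀ P → IsOpenPacking H P → ∣ P ∣ ≤ ρoH) → sum onIGH⁻ + iG * iH ≤ iG * ρoH
  isolated-rows-bound {ρoH} maxH = begin
    sum onIGH⁻ + iG * iH                                         ≡⟨ cong (_+_ (sum onIGH⁻)) (count*≡sum-if (isIsolated G) iH) ⟩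
    sum onIGH⁻ + sum (λ g → if isIsolated G g then iH else 0)    ≡⟨ ∑-distrib-+ onIGH⁻ _ ⟨
    sum (λ g → onIGH⁻ g + (if isIsolated G g then iH else 0))    ≡⟨ sum-cong-≗ (λ g → if-+ (isIsolated G g)) ⟩
    sum (λ g → if isIsolated G g then rowH⁻ g + iH else 0)       ≤⟨ sum-if≤count* (isIsolated G) _ ρoH rowH⁻+iH≤ρoH ⟩
    iG * ρoH                                                     ∎
    where
    open ≤-Reasoning
    if-+ : ∀ {x y} b → (if b then x else 0) + (if b then y else 0) ≡ (if b then x + y else 0)
    if-+ true  = refl
    if-+ false = refl
    join : ∀ b s → (if not b then 𝟙 s else 0) + 𝟙 b ≡ 𝟙 (b ∨ s)
    join true  s = refl
    join false s = +-identityʳ (𝟙 s)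
    rowH⁻+iH≤ρoH : ∀ g → rowH⁻ g + iH ≤ ρoH
    rowH⁻+iH≤ρoH g = begin
      rowH⁻ g + iH                                        ≡⟨ ∑-distrib-+ (onH⁻ g) (𝟙 ∘ isIsolated H) ⟨
      sum (λ h → onH⁻ g h + 𝟙 (isIsolated H h))           ≡⟨ sum-cong-≗ (λ h → join (isIsolated H h) (S (g , h))) ⟩
      count (λ h → isIsolated H h ∨ S (g , h))            ≡⟨ ∣tabulate∣≡count (λ h → isIsolated H h ∨ S (g , h)) ⟨
      ∣ Vec.tabulate (λ h → isIsolated H h ∨ S (g , h)) ∣ ≤⟨ maxH _ (openPacking-∪isolated H _ (openPacking⊠-slice₂ g)) ⟩
      ρoH                                                 ∎

  isolated-columns-bound : ∀ {ρoG} → (∀ P → IsOpenPacking G P → ∣ P ∣ ≤ ρoG) → sum (sum ∘ onIH) ≤ iH * ρoG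
  isolated-columns-bound {ρoG} maxG = begin
    sum (sum ∘ onIH)                                                     ≡⟨ ∑-comm onIH ⟩
    sum (λ h → sum (λ g → onIH g h))                                     ≡⟨ sum-cong-≗ (λ h → sum-if (isIsolated H h) (λ g → 𝟙 (S (g , h)))) ⟩
    sum (λ h → if isIsolated H h then count (λ g → S (g , h)) else 0)   ≤⟨ sum-if≤count* (isIsolated H) _ ρoG column≤ρoG ⟩
    iH * ρoG                                                             ∎
    where
    open ≤-Reasoning
    column≤ρoG : ∀ h → count (λ g → S (g , h)) ≤ ρoG
    column≤ρoG h = subst (_≤ ρoG) (∣tabulate∣≡count (λ g → S (g , h))) (maxG _ (openPacking⊠-slice₁ h))

  openPacking⊠-count-bound : ∀ {ρoG ρoH} → (∀ P → IsOpenPacking G P → ∣ P ∣ ≤ ρoG) → (∀ P → IsOpenPacking H P → ∣ P ∣ ≤ ρoH) →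
    count² S + iG * iH ≤ count² (S ∘ embed⁻² G H) + (iG * ρoH + iH * ρoG)
  openPacking⊠-count-bound {ρoG} {ρoH} maxG maxH = begin
    count² S + iG * iH                                        ≡⟨ cong (_+ iG * iH) count²-split ⟩
    sum onG⁻H⁻ + sum onIGH⁻ + sum (sum ∘ onIH) + iG * iH      ≡⟨ rearrange (sum onG⁻H⁻) (sum onIGH⁻) (sum (sum ∘ onIH)) (iG * iH) ⟩
    sum onG⁻H⁻ + ((sum onIGH⁻ + iG * iH) + sum (sum ∘ onIH))  ≤⟨ +-mono-≤ (≤-reflexive sum-onG⁻H⁻≡count²⁻)
                                                                   (+-mono-≤ (isolated-rows-bound maxH) (isolated-columns-bound maxG)) ⟩
    count² (S ∘ embed⁻² G H) + (iG * ρoH + iH * ρoG)         ∎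
    where
    open ≤-Reasoning
    open +-*-Solver
    rearrange : ∀ a b c d → a + b + c + d ≡ a + ((b + d) + c)
    rearrange = solve 4 (λ a b c d → a :+ b :+ c :+ d := a :+ ((b :+ d) :+ c)) refl

-- Open packings of G ⊠ H: the lower bound

module _ {k} (K : Graph k) (P : Subset (minusSize K)) where

  image⁻ : Fin k → Bool
  image⁻ v = isYes (any? λ i → (i ∈? P) ×-dec (embed⁻ K i ≟ v))

  image⁻-witness : ∀ {v} → T (image⁻ v) → ∃ λ i → i ∈ P × embed⁻ K i ≡ v
  image⁻-witness = toWitness

  image⁻-nonIsolated : ∀ {v} → T (image⁻ v) → ¬ Isolated K v
  image⁻-nonIsolated v∈ with image⁻-witness v∈
  ... | i , _ , refl = embed⁻-nonIsolated K i

  image⁻-∈N̄-meet : IsPacking (K ⁻) P → ∀ {u v w} → T (image⁻ u) → T (image⁻ v) →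
    w ∈N̄[ K ] u → w ∈N̄[ K ] v → u ≡ v
  image⁻-∈N̄-meet pk u∈ v∈ w∈N̄u w∈N̄v with image⁻-witness u∈ | image⁻-witness v∈
  ... | i , i∈P , refl | j , j∈P , refl with embed⁻-surjective K (∈N̄⇒nonIsolated K (embed⁻-nonIsolated K i) w∈N̄u)
  ... | l , refl with i ≟ j
  ...   | yes i≡j = cong (embed⁻ K) i≡j
  ...   | no i≢j  = contradiction (∈N̄⇒∈N̄⁻ K w∈N̄u , ∈N̄⇒∈N̄⁻ K w∈N̄v) (pk i j i∈P j∈P i≢j l)

  ∣P∣≤count-image⁻ : ∣ P ∣ ≤ count image⁻
  ∣P∣≤count-image⁻ = begin
    ∣ P ∣                                                           ≡⟨ ∣P∣≡count P ⟩
    count (Vec.lookup P)                                            ≤⟨ sum-mono-≤ member⇒image ⟩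
    sum (λ i → 𝟙 (image⁻ (embed⁻ K i)))                             ≡⟨ sum-embed⁻ K (𝟙 ∘ image⁻) ⟩
    sum (λ v → if not (isIsolated K v) then 𝟙 (image⁻ v) else 0)   ≤⟨ sum-mono-≤ (λ v → if≤ (not (isIsolated K v)) (𝟙 (image⁻ v))) ⟩
    count image⁻                                                    ∎
    where
    open ≤-Reasoning
    𝟙-mono : ∀ {a b} → (T a → T b) → 𝟙 a ≤ 𝟙 b
    𝟙-mono {false}         _   = z≤n
    𝟙-mono {true}  {true}  _   = ≤-refl
    𝟙-mono {true}  {false} a⇒b = contradiction _ a⇒b
    member⇒image : ∀ i → 𝟙 (Vec.lookup P i) ≤ 𝟙 (image⁻ (embed⁻ K i))
    member⇒image i = 𝟙-mono (λ i∈P → fromWitness (i , T⇒∈ i∈P , refl))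
    if≤ : ∀ b x → (if b then x else 0) ≤ x
    if≤ true  x = ≤-refl
    if≤ false x = z≤n

module _ {n m} (G : Graph n) (H : Graph m)
         {PG : Subset (minusSize G)} {PH : Subset (minusSize H)} {OG : Subset n} {OH : Subset m}
         (pkG : IsPacking (G ⁻) PG) (pkH : IsPacking (H ⁻) PH)
         (opG : IsOpenPacking G OG) (opH : IsOpenPacking H OH) where

  private
    Box IsolatedOpen OpenIsolated : Fin n × Fin m → Bool
    Box          (g , h) = image⁻ G PG g ∧ image⁻ H PH h
    IsolatedOpen (g , h) = isIsolated G g ∧ Vec.lookup OH h
    OpenIsolated (g , h) = Vec.lookup OG g ∧ isIsolated H h

  boxUnion : Fin n × Fin m → Bool
  boxUnion p = Box p ∨ IsolatedOpen p ∨ OpenIsolated p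

  private
    data Kind (p : Fin n × Fin m) : Set where
      box          : T (image⁻ G PG (proj₁ p)) → T (image⁻ H PH (proj₂ p)) → Kind p
      isolatedOpen : Isolated G (proj₁ p) → proj₂ p ∈ OH → Kind p
      openIsolated : proj₁ p ∈ OG → Isolated H (proj₂ p) → Kind p

    kind : ∀ p → T (boxUnion p) → Kind p
    kind p p∈ with Equivalence.to T-∨ p∈
    ... | inj₁ b = let (b₁ , b₂) = Equivalence.to T-∧ b in box b₁ b₂
    ... | inj₂ r with Equivalence.to T-∨ r
    ...   | inj₁ y = let (y₁ , y₂) = Equivalence.to T-∧ y in isolatedOpen y₁ (T⇒∈ y₂)
    ...   | inj₂ z = let (z₁ , z₂) = Equivalence.to T-∧ z in openIsolated (T⇒∈ z₁) z₂

    boxUnion-meet : ∀ {p q w} → Kind p → Kind q → w ∈N⟨ G ⊠ H ⟩ p → w ∈N⟨ G ⊠ H ⟩ q → p ≡ q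
    boxUnion-meet (box a b) (box c d) (_ , wp₁ , wp₂) (_ , wq₁ , wq₂) =
      ×-≡,≡→≡ (image⁻-∈N̄-meet G PG pkG a c wp₁ wq₁ , image⁻-∈N̄-meet H PH pkH b d wp₂ wq₂)
    boxUnion-meet (box a _) (isolatedOpen i _) (_ , wp₁ , _) (_ , wq₁ , _) =
      contradiction (isolated-∈N̄-meet⇒isolated G i wq₁ wp₁) (image⁻-nonIsolated G PG a)
    boxUnion-meet (box _ b) (openIsolated _ i) (_ , _ , wp₂) (_ , _ , wq₂) =
      contradiction (isolated-∈N̄-meet⇒isolated H i wq₂ wp₂) (image⁻-nonIsolated H PH b)
    boxUnion-meet (isolatedOpen i _) (box a _) (_ , wp₁ , _) (_ , wq₁ , _) =
      contradiction (isolated-∈N̄-meet⇒isolated G i wp₁ wq₁) (image⁻-nonIsolated G PG a)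
    boxUnion-meet (openIsolated _ i) (box _ b) (_ , _ , wp₂) (_ , _ , wq₂) =
      contradiction (isolated-∈N̄-meet⇒isolated H i wp₂ wq₂) (image⁻-nonIsolated H PH b)
    boxUnion-meet (isolatedOpen i o) (isolatedOpen i′ o′) wp@(_ , wp₁ , _) wq@(_ , wq₁ , _) =
      let p₁≡w₁ = isolated⇒∈N̄⇒≡ G i wp₁ ; q₁≡w₁ = isolated⇒∈N̄⇒≡ G i′ wq₁
      in ×-≡,≡→≡ (trans p₁≡w₁ (sym q₁≡w₁) , openPacking-∈N-meet H opH o o′ (∈N⊠⇒∈N₂ G H wp p₁≡w₁) (∈N⊠⇒∈N₂ G H wq q₁≡w₁))
    boxUnion-meet (openIsolated o i) (openIsolated o′ i′) wp@(_ , _ , wp₂) wq@(_ , _ , wq₂) =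
      let p₂≡w₂ = isolated⇒∈N̄⇒≡ H i wp₂ ; q₂≡w₂ = isolated⇒∈N̄⇒≡ H i′ wq₂
      in ×-≡,≡→≡ (openPacking-∈N-meet G opG o o′ (∈N⊠⇒∈N₁ G H wp p₂≡w₂) (∈N⊠⇒∈N₁ G H wq q₂≡w₂) , trans p₂≡w₂ (sym q₂≡w₂))
    boxUnion-meet (isolatedOpen i _) (openIsolated _ i′) (_ , wp₁ , wp₂) (_ , wq₁ , wq₂) =
      ×-≡,≡→≡ (sym (isolated-∈N̄-meet G i wp₁ wq₁) , isolated-∈N̄-meet H i′ wq₂ wp₂)
    boxUnion-meet (openIsolated _ i) (isolatedOpen i′ _) (_ , wp₁ , wp₂) (_ , wq₁ , wq₂) =
      ×-≡,≡→≡ (isolated-∈N̄-meet G i′ wq₁ wp₁ , sym (isolated-∈N̄-meet H i wp₂ wq₂))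

  boxUnion-openPacking : IsOpenPacking⊠ G H boxUnion
  boxUnion-openPacking p q p∈ q∈ p≢q w (wp , wq) = p≢q (boxUnion-meet (kind p p∈) (kind q q∈) wp wq)

  private
    iG = count (isIsolated G)
    iH = count (isIsolated H)

    parts-count : ∣ PG ∣ * ∣ PH ∣ + iG * ∣ OH ∣ + iH * ∣ OG ∣ ≤ count² Box + count² IsolatedOpen + count² OpenIsolated
    parts-count = begin
      ∣ PG ∣ * ∣ PH ∣ + iG * ∣ OH ∣ + iH * ∣ OG ∣
        ≤⟨ +-mono-≤ (+-mono-≤ (*-mono-≤ (∣P∣≤count-image⁻ G PG) (∣P∣≤count-image⁻ H PH))
                              (≤-reflexive (cong (iG *_) (∣P∣≡count OH))))
                    (≤-reflexive (trans (*-comm iH ∣ OG ∣) (cong (_* iH) (∣P∣≡count OG)))) ⟩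
      count (image⁻ G PG) * count (image⁻ H PH) + iG * count (Vec.lookup OH) + count (Vec.lookup OG) * iH
        ≡⟨ cong₂ _+_ (cong₂ _+_ (count-× (image⁻ G PG) (image⁻ H PH)) (count-× (isIsolated G) (Vec.lookup OH)))
                     (count-× (Vec.lookup OG) (isIsolated H)) ⟨
      count² Box + count² IsolatedOpen + count² OpenIsolated ∎
      where open ≤-Reasoning

    pointwise : ∀ p → 𝟙 (Box p) + 𝟙 (IsolatedOpen p) + 𝟙 (OpenIsolated p)
                      ≤ 𝟙 (boxUnion p) + 𝟙 (isIsolated G (proj₁ p) ∧ isIsolated H (proj₂ p))
    pointwise p@(g , h) = 𝟙-union-bound (Box p) (IsolatedOpen p) (OpenIsolated p) _
      (λ b y → image⁻-nonIsolated G PG (proj₁ (Equivalence.to T-∧ b)) (proj₁ (Equivalence.to T-∧ y)))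
      (λ b z → image⁻-nonIsolated H PH (proj₂ (Equivalence.to T-∧ b)) (proj₂ (Equivalence.to T-∧ z)))
      (λ y z → Equivalence.from (T-∧ {isIsolated G g})
                 (proj₁ (Equivalence.to (T-∧ {isIsolated G g}) y) , proj₂ (Equivalence.to (T-∧ {Vec.lookup OG g}) z)))

  boxUnion-count : ∣ PG ∣ * ∣ PH ∣ + iG * ∣ OH ∣ + iH * ∣ OG ∣ ≤ count² boxUnion + iG * iH
  boxUnion-count = begin
    ∣ PG ∣ * ∣ PH ∣ + iG * ∣ OH ∣ + iH * ∣ OG ∣
      ≤⟨ parts-count ⟩
    count² Box + count² IsolatedOpen + count² OpenIsolated
      ≡⟨ trans (sum²-distrib-+ (λ p → 𝟙 (Box p) + 𝟙 (IsolatedOpen p)) (𝟙 ∘ OpenIsolated))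
               (cong (_+ count² OpenIsolated) (sum²-distrib-+ (𝟙 ∘ Box) (𝟙 ∘ IsolatedOpen))) ⟨
    sum² (λ p → 𝟙 (Box p) + 𝟙 (IsolatedOpen p) + 𝟙 (OpenIsolated p))
      ≤⟨ sum²-mono-≤ pointwise ⟩
    sum² (λ p → 𝟙 (boxUnion p) + 𝟙 (isIsolated G (proj₁ p) ∧ isIsolated H (proj₂ p)))
      ≡⟨ sum²-distrib-+ (𝟙 ∘ boxUnion) (λ p → 𝟙 (isIsolated G (proj₁ p) ∧ isIsolated H (proj₂ p))) ⟩
    count² boxUnion + sum (λ g → count (λ h → isIsolated G g ∧ isIsolated H h))
      ≡⟨ cong (_+_ (count² boxUnion)) (count-× (isIsolated G) (isIsolated H)) ⟩
    count² boxUnion + iG * iH ∎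
    where open ≤-Reasoning

module _ {n m} (G : Graph n) (H : Graph m) where

  private
    iG = isolatedCount G
    iH = isolatedCount H
    cG = count (isIsolated G)
    cH = count (isIsolated H)
    iG≡cG : iG ≡ cG
    iG≡cG = isolatedCount≡count G
    iH≡cH : iH ≡ cH
    iH≡cH = isolatedCount≡count H

  openPacking⊠-lower-bound : ∀ {PG PH OG OH} → IsPacking (G ⁻) PG → IsPacking (H ⁻) PH →
    IsOpenPacking G OG → IsOpenPacking H OH →
    ∃ λ P → IsOpenPacking (G ⊠ H) P × ∣ PG ∣ * ∣ PH ∣ + iG * ∣ OH ∣ + iH * ∣ OG ∣ ≤ ∣ P ∣ + iG * iH
  openPacking⊠-lower-bound {PG} {PH} {OG} {OH} PG-packing PH-packing OG-open OH-open =
    Vec.tabulate (S ∘ coords G H) , openPacking⊠⁺ G H (boxUnion-openPacking G H PG-packing PH-packing OG-open OH-open) ,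
    subst₂ (λ x y → ∣ PG ∣ * ∣ PH ∣ + x * ∣ OH ∣ + y * ∣ OG ∣ ≤ ∣ Vec.tabulate (S ∘ coords G H) ∣ + x * y)
      (sym iG≡cG) (sym iH≡cH)
      (subst (λ c → ∣ PG ∣ * ∣ PH ∣ + cG * ∣ OH ∣ + cH * ∣ OG ∣ ≤ c + cG * cH) (sym (∣tabulate∣≡count² G H S))
        (boxUnion-count G H PG-packing PH-packing OG-open OH-open))
    where
    S = boxUnion G H PG-packing PH-packing OG-open OH-open

  openPacking⊠-upper-bound : ∀ {P ρG⁻ ρH⁻ ρoG ρoH fG fH} → IsOpenPacking (G ⊠ H) P →
    (∀ Q → IsPacking (G ⁻) Q → ∣ Q ∣ ≤ ρG⁻) → (∀ Q → IsPacking (H ⁻) Q → ∣ Q ∣ ≤ ρH⁻) →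
    (∀ Q → IsOpenPacking G Q → ∣ Q ∣ ≤ ρoG) → (∀ Q → IsOpenPacking H Q → ∣ Q ∣ ≤ ρoH) →
    IsFracDom (G ⁻) fG → IsFracDom (H ⁻) fH →
    toℚ (∣ P ∣ + iG * iH) ≤ℚ ((toℚ ρG⁻ *ℚ weight fH) ⊓ (toℚ ρH⁻ *ℚ weight fG)) +ℚ toℚ (iG * ρoH + iH * ρoG)
  openPacking⊠-upper-bound {P} {ρG⁻} {ρH⁻} {ρoG} {ρoH} {fG} {fH} P-open maxPG maxPH maxOG maxOH fG-dom fH-dom = begin
    toℚ (∣ P ∣ + iG * iH)                  ≡⟨ cong toℚ (cong₂ _+_ (∣P∣≡count² G H P) (cong₂ _*_ iG≡cG iH≡cH)) ⟩
    toℚ (count² S + cG * cH)               ≤⟨ toℚ-mono (openPacking⊠-count-bound G H S-open maxOG maxOH) ⟩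
    toℚ (count² S⁻ + X)                    ≡⟨ toℚ-+ (count² S⁻) X ⟩
    toℚ (count² S⁻) +ℚ toℚ X               ≤⟨ ℚ.+-monoˡ-≤ (toℚ X) (ℚ.⊓-glb via-G via-H) ⟩
    ((toℚ ρG⁻ *ℚ weight fH) ⊓ (toℚ ρH⁻ *ℚ weight fG)) +ℚ toℚ X
      ≡⟨ cong (λ x → ((toℚ ρG⁻ *ℚ weight fH) ⊓ (toℚ ρH⁻ *ℚ weight fG)) +ℚ toℚ x)
              (cong₂ _+_ (cong (_* ρoH) iG≡cG) (cong (_* ρoG) iH≡cH)) ⟨
    ((toℚ ρG⁻ *ℚ weight fH) ⊓ (toℚ ρH⁻ *ℚ weight fG)) +ℚ toℚ (iG * ρoH + iH * ρoG) ∎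
    where
    open ℚ.≤-Reasoning
    X = cG * ρoH + cH * ρoG
    S = Vec.lookup P ∘ ⟪_⟫ G H
    S-open = openPacking⊠⁻ G H {P} P-open
    S⁻ = S ∘ embed⁻² G H
    S⁻-packing = openPacking⊠⇒packing⊠⁻ G H S-open
    via-G : toℚ (count² S⁻) ≤ℚ toℚ ρG⁻ *ℚ weight fH
    via-G = packing⊠-bound (G ⁻) (H ⁻) S⁻-packing maxPG fH-dom
    via-H : toℚ (count² S⁻) ≤ℚ toℚ ρH⁻ *ℚ weight fG
    via-H = subst (λ c → toℚ c ≤ℚ toℚ ρH⁻ *ℚ weight fG) (count²-swap S⁻)
      (packing⊠-bound (H ⁻) (G ⁻) (packing⊠-swap (G ⁻) (H ⁻) S⁻-packing) maxPH fG-dom)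

theorem10 : ∀ {n m} (G : Graph n) (H : Graph m)
    (ρo⊠ ρG⁻ ρH⁻ ρoG ρoH : ℕ) (γG⁻ γH⁻ : ℚ) →
    IsOpenPackingNumber (G ⊠ H) ρo⊠ →
    IsPackingNumber (G ⁻) ρG⁻ →
    IsPackingNumber (H ⁻) ρH⁻ →
    IsOpenPackingNumber G ρoG →
    IsOpenPackingNumber H ρoH →
    IsFracDomNumber (G ⁻) γG⁻ →
    IsFracDomNumber (H ⁻) γH⁻ →
    (ρG⁻ * ρH⁻ + isolatedCount G * ρoH + isolatedCount H * ρoG
        ≤ ρo⊠ + isolatedCount G * isolatedCount H)
    ×
    (((+ (ρo⊠ + isolatedCount G * isolatedCount H)) / 1)
        ≤ℚ (((((+ ρG⁻) / 1) *ℚ γH⁻) ⊓ (((+ ρH⁻) / 1) *ℚ γG⁻))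
            +ℚ ((+ (isolatedCount G * ρoH + isolatedCount H * ρoG)) / 1)))
theorem10 G H _ _ _ _ _ _ _
  ((P , P-open , refl) , maxOpen⊠) ((_ , PG-packing , refl) , maxPG) ((_ , PH-packing , refl) , maxPH)
  ((_ , OG-open , refl) , maxOG) ((_ , OH-open , refl) , maxOH) ((_ , fG-dom , refl) , _) ((_ , fH-dom , refl) , _) =
  let (Q , Q-open , bound) = openPacking⊠-lower-bound G H PG-packing PH-packing OG-open OH-open
  in ≤-trans bound (+-monoˡ-≤ _ (maxOpen⊠ Q Q-open)) ,
     openPacking⊠-upper-bound G H P-open maxPG maxPH maxOG maxOH fG-dom fH-dom
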